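{- Let $\mathbf r\in\mathcal R$ and define $\tau=2$ if $r_1=1$ and $\ell<\sigma_3-\sigma_1$, and $\tau=1$ otherwise. If $t\ge\tau$ is an integer, then $U_{\mathbf r}(t)=g_1g_2g_3\in\mathcal S$, where $g_\nu=r_\nu(\sigma_3t+\ell)+1$ ($\nu=1,2,3$), and $g_1\cdot g_2\cdot g_3$ is a strict $s$-decomposition of $U_{\mathbf r}(t)$, i.e. $s_{g_\nu}(U_{\mathbf r}(t))=g_\nu$ for $\nu=1,2,3$. Moreover, if each $g_\nu$ is an odd prime, then $U_{\mathbf r}(t)$ is a primary Carmichael number with exactly three prime factors, i.e. $U_{\mathbf r}(t)\in\mathcal C'_3$.
   Context: $\mathcal R$ is the set of triples $\mathbf r=(r_1,r_2,r_3)$ of pairwise coprime positive integers with $r_1<r_2<r_3$. For $\mathbf r\in\mathcal R$ put $\sigma_1=r_1+r_2+r_3$, $\sigma_2=r_1r_2+r_1r_3+r_2r_3$, $\sigma_3=r_1r_2r_3$, and let $\ell$ be the unique integer with $0\le\ell<\sigma_3$ and $\ell\sigma_2\equiv-\sigma_1\pmod{\sigma_3}$. Define $U_{\mathbf r}(t)=\prod_{\nu=1}^3(r_\nu(\sigma_3t+\ell)+1)$. For an integer base $g\ge2$ and $m\ge0$, $s_g(m)$ is the sum of base-$g$ digits of $m$. A strict $s$-decomposition of a positive integer $m$ is a factorization $m=\prod_{\nu=1}^n g_\nu^{e_\nu}$, $e_\nu\ge1$, with proper factors $1<g_\nu<m$, $g_1<\dots<g_n$ (not necessarily coprime) and $s_{g_\nu}(m)=g_\nu$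 for all $\nu$; $\mathcal S$ is the set of positive integers admitting one. $\mathcal C'_3$ is the set of squarefree integers $m>1$ with exactly three prime factors such that $s_p(m)=p$ for every prime $p\mid m$. -}

module Defs where

open import Data.Nat using (ℕ; zero; suc; _+_; _*_; _^_; _<_; _≤_; _≡ᵇ_)
open import Data.Nat.DivMod using (_%_; _/_)
open import Data.Nat.Divisibility using (_∣_)
open import Data.Nat.Coprimality using (Coprime)
open import Data.Nat.Primality using (Prime)
open import Data.List using (List; []; _∷_; foldr)
open import Data.List.Relation.Unary.All using (All)
open import Data.List.Relation.Unary.Linked using (Linked)
open import Data.Product using (_×_; _,_; proj₁; proj₂; ∃; ∃-syntax; Σ)
open import Data.Sum using (_⊎_)
open import Relation.Binary.PropositionalEquality using (_≡_)
open import Function.Bundles using (_⇔_)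

-- Sum of base-g digits of m.  The fuel argument bounds the number of
-- digits; fuel m is always enough since m < g ^ m for g ≥ 2.
-- For bases g < 2 (never used below) the value is fixed to 0.
digitSumFuel : (b : ℕ) → ℕ → ℕ → ℕ
digitSumFuel b zero    m = zero
digitSumFuel b (suc f) m = m % suc (suc b) + digitSumFuel b f (m / suc (suc b))

s : ℕ → ℕ → ℕ
s (suc (suc b)) m = digitSumFuel b m m
s _             m = zero

record InR (r₁ r₂ r₃ : ℕ) : Set where
  field
    pos₁  : 0 < r₁
    lt₁₂  : r₁ < r₂
    lt₂₃  : r₂ < r₃
    cop₁₂ : Coprime r₁ r₂
    cop₁₃ : Coprime r₁ r₃
    cop₂₃ : Coprime r₂ r₃

σ₁ σ₂ σ₃ : ℕ → ℕ → ℕ → ℕ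
σ₁ r₁ r₂ r₃ = r₁ + r₂ + r₃
σ₂ r₁ r₂ r₃ = r₁ * r₂ + r₁ * r₃ + r₂ * r₃
σ₃ r₁ r₂ r₃ = r₁ * r₂ * r₃

-- ℓ is characterised by 0 ≤ ℓ < σ₃ and ℓ σ₂ ≡ -σ₁ (mod σ₃),
-- i.e. σ₃ ∣ ℓ σ₂ + σ₁.
IsEll : ℕ → ℕ → ℕ → ℕ → Set
IsEll r₁ r₂ r₃ ℓ = ℓ < σ₃ r₁ r₂ r₃ × σ₃ r₁ r₂ r₃ ∣ ℓ * σ₂ r₁ r₂ r₃ + σ₁ r₁ r₂ r₃

gfac : ℕ → ℕ → ℕ → ℕ → ℕ
gfac σ ℓ t rν = rν * (σ * t + ℓ) + 1

U : ℕ → ℕ → ℕ → ℕ → ℕ → ℕ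
U r₁ r₂ r₃ ℓ t =
  gfac (σ₃ r₁ r₂ r₃) ℓ t r₁ * gfac (σ₃ r₁ r₂ r₃) ℓ t r₂ * gfac (σ₃ r₁ r₂ r₃) ℓ t r₃

-- τ = 2 if r₁ = 1 and ℓ < σ₃ - σ₁ (written ℓ + σ₁ < σ₃), τ = 1 otherwise.
-- Encoded as a relation: TauBound r₁ r₂ r₃ ℓ t  means  t ≥ τ.
TauBound : ℕ → ℕ → ℕ → ℕ → ℕ → Set
TauBound r₁ r₂ r₃ ℓ t =
  (r₁ ≡ 1 × ℓ + σ₁ r₁ r₂ r₃ < σ₃ r₁ r₂ r₃ → 2 ≤ t) × 1 ≤ t

prodPow : List (ℕ × ℕ) → ℕ
prodPow = foldr (λ p acc → proj₁ p ^ proj₂ p * acc) 1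

_<fst_ : (ℕ × ℕ) → (ℕ × ℕ) → Set
p <fst q = proj₁ p < proj₁ q

IsStrictSDecomp : ℕ → List (ℕ × ℕ) → Set
IsStrictSDecomp m ds =
  m ≡ prodPow ds
  × Linked _<fst_ ds
  × All (λ p → 1 < proj₁ p × proj₁ p < m × 1 ≤ proj₂ p × s (proj₁ p) m ≡ proj₁ p) ds

InS : ℕ → Set
InS m = 0 < m × ∃[ ds ] IsStrictSDecomp m ds

Squarefree : ℕ → Set
Squarefree m = ∀ d → d * d ∣ m → d ≡ 1

HasExactlyThreePrimeFactors : ℕ → Set
HasExactlyThreePrimeFactors m =
  ∃[ p ] ∃[ q ] ∃[ r ] (Prime p × Prime q × Prime r × p < q × q < r
    × (∀ x → Prime x → (x ∣ m ⇔ (x ≡ p ⊎ x ≡ q ⊎ x ≡ r))))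

InC3' : ℕ → Set
InC3' m = 1 < m × Squarefree m × HasExactlyThreePrimeFactors m
          × (∀ p → Prime p → p ∣ m → s p m ≡ p)

OddPrime : ℕ → Set
OddPrime p = Prime p × p % 2 ≡ 1

{-# OPTIONS --safe #-}
module Submission where

-- Put x = σ₃ t + ℓ and consider one factor g = r x + 1, with a and b the other two r's.
-- Since (a x + 1)(b x + 1) = x (a b x + a + b) + 1 and the congruence defining ℓ makes r
-- divide a b x + a + b, it suffices to write (a b x + a + b) / r = q g + w with q < w ≤ r x
-- and 2 ≤ w: then U = g ((g − 1)(q g + w) + 1) has base-g digits q, w − q − 1, g − w + 1, 0,
-- which sum to g.  For r ≥ 2 take q = ⌊a b / r²⌋, with a nonzero remainder because r is
-- coprime to a b; for r = 1 take q = a b − 1, where t ≥ τ provides the room needed for w.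

open import Defs
open import Data.Nat
open import Data.Nat.Properties
open import Data.Nat.DivMod
open import Data.Nat.Divisibility
open import Data.Nat.Coprimality as Coprimality using (Coprime; coprime-divisor)
open import Data.Nat.Primality
open import Data.Nat.Tactic.RingSolver
open import Data.Product using (_×_; _,_; proj₁; proj₂)
open import Data.Sum using (_⊎_; inj₁; inj₂)
open import Data.List using ([]; _∷_)
open import Data.List.Relation.Unary.All using ([]; _∷_)
open import Data.List.Relation.Unary.Linked using ([-]; _∷_)
open import Function.Base using (_∘_)
open import Function.Bundles using (_⇔_; mk⇔; Equivalence)
open import Relation.Nullary using (¬_; yes; no; contradiction)
open import Relation.Binary.PropositionalEquality

digitSumFuel-zero : ∀ b f → digitSumFuel b f 0 ≡ 0
digitSumFuel-zero b zero    = refl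
digitSumFuel-zero b (suc f) = trans (cong (digitSumFuel b f) (0/n≡0 (2 + b))) (digitSumFuel-zero b f)

digitSumFuel-fuelIrrelevant : ∀ b {f f′ n} → n ≤ f → n ≤ f′ →
  digitSumFuel b f n ≡ digitSumFuel b f′ n
digitSumFuel-fuelIrrelevant b {f} {f′} {zero} _ _ =
  trans (digitSumFuel-zero b f) (sym (digitSumFuel-zero b f′))
digitSumFuel-fuelIrrelevant b {suc f} {suc f′} {n@(suc _)} (s≤s n≤f) (s≤s n≤f′) =
  cong (n % (2 + b) +_) (digitSumFuel-fuelIrrelevant b (≤-trans n/g≤ n≤f) (≤-trans n/g≤ n≤f′))
  where
  n/g≤ : n / (2 + b) ≤ pred n
  n/g≤ = ≤-pred (m/n<m n (2 + b) (s≤s (s≤s z≤n)))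

s[d+n*g]≡d+s[n] : ∀ {g d} n → 2 ≤ g → d < g → s g (d + n * g) ≡ d + s g n
s[d+n*g]≡d+s[n] {g@(suc (suc b))} {d} n (s≤s (s≤s z≤n)) d<g = begin
  digitSumFuel b m m                           ≡⟨ digitSumFuel-fuelIrrelevant b ≤-refl (n≤1+n m) ⟩
  m % g + digitSumFuel b m (m / g)             ≡⟨ cong₂ (λ u v → u + digitSumFuel b m v) m%g≡d m/g≡n ⟩
  d + digitSumFuel b m n                       ≡⟨ cong (d +_) (digitSumFuel-fuelIrrelevant b n≤m ≤-refl) ⟩
  d + digitSumFuel b n n                       ∎
  where
  open ≡-Reasoning
  m = d + n * g
  n≤m : n ≤ m
  n≤m = ≤-trans (m≤m*n n g) (m≤n+m (n * g) d)
  m%g≡d : m % g ≡ d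
  m%g≡d = trans ([m+kn]%n≡m%n d n g) (m<n⇒m%n≡m d<g)
  m/g≡n : m / g ≡ n
  m/g≡n = trans (+-distrib-/-∣ʳ d (n∣m*n n)) (cong₂ _+_ (m<n⇒m/n≡0 d<g) (m*n/n≡m n g))

s[d]≡d : ∀ {g d} → 2 ≤ g → d < g → s g d ≡ d
s[d]≡d {g@(suc (suc _))} {d} 2≤g@(s≤s (s≤s z≤n)) d<g = begin
  s g d             ≡⟨ cong (s g) (sym (+-identityʳ d)) ⟩
  s g (d + 0 * g)   ≡⟨ s[d+n*g]≡d+s[n] 0 2≤g d<g ⟩
  d + s g 0         ≡⟨ +-identityʳ d ⟩
  d                 ∎
  where open ≡-Reasoning

s-threeDigits : ∀ {g d₀ d₁ d₂} → 2 ≤ g → d₀ < g → d₁ < g → d₂ < g →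
  s g ((d₀ + (d₁ + d₂ * g) * g) * g) ≡ d₀ + (d₁ + d₂)
s-threeDigits {g} {d₀} {d₁} {d₂} 2≤g d₀<g d₁<g d₂<g = begin
  s g ((d₀ + (d₁ + d₂ * g) * g) * g)   ≡⟨ s[d+n*g]≡d+s[n] (d₀ + (d₁ + d₂ * g) * g) 2≤g (≤-trans (s≤s z≤n) 2≤g) ⟩
  s g (d₀ + (d₁ + d₂ * g) * g)         ≡⟨ s[d+n*g]≡d+s[n] (d₁ + d₂ * g) 2≤g d₀<g ⟩
  d₀ + s g (d₁ + d₂ * g)               ≡⟨ cong (d₀ +_) (s[d+n*g]≡d+s[n] d₂ 2≤g d₁<g) ⟩
  d₀ + (d₁ + s g d₂)                   ≡⟨ cong (λ z → d₀ + (d₁ + z)) (s[d]≡d 2≤g d₂<g) ⟩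
  d₀ + (d₁ + d₂)                       ∎
  where open ≡-Reasoning

s[g*[y*[q*g+w]+1]]≡g : ∀ {y q w} → 2 ≤ w → q < w → w ≤ y →
  s (y + 1) ((y + 1) * (y * (q * (y + 1) + w) + 1)) ≡ y + 1
s[g*[y*[q*g+w]+1]]≡g {y} {q} {w} 2≤w q<w w≤y with m≤n⇒∃[o]m+o≡n q<w | m≤n⇒∃[o]m+o≡n w≤y
... | e , refl | h , refl = begin
  s g (g * (y * (q * g + w) + 1))      ≡⟨ cong (s g) (digits q e h) ⟩
  s g ((2 + h + (e + q * g) * g) * g)  ≡⟨ s-threeDigits 2≤g (≤-<-trans (+-monoˡ-≤ h 2≤w) y<g)
                                              (<-trans (m<n+m e (s≤s z≤n)) (≤-<-trans (m≤m+n w h) y<g))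
                                              (<-trans q<w (≤-<-trans (m≤m+n w h) y<g)) ⟩
  2 + h + (e + q)                      ≡⟨ digitSum q e h ⟩
  g                                    ∎
  where
  open ≡-Reasoning
  g = y + 1
  y<g : y < g
  y<g = m<m+n y (s≤s z≤n)
  2≤g : 2 ≤ g
  2≤g = ≤-trans 2≤w (≤-trans (m≤m+n w h) (<⇒≤ y<g))
  digits : ∀ q e h → let y = suc q + e + h; g = y + 1 in
    g * (y * (q * g + (suc q + e)) + 1) ≡ (2 + h + (e + q * g) * g) * g
  digits = solve-∀
  digitSum : ∀ q e h → 2 + h + (e + q) ≡ suc q + e + h + 1
  digitSum = solve-∀

record QuotientDigits (r a b x : ℕ) : Set where
  field
    q w       : ℕ
    expansion : r * (q * (r * x + 1) + w) ≡ a * b * x + a + b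
    2≤w       : 2 ≤ w
    q<w       : q < w
    w≤rx      : w ≤ r * x

s-factor : ∀ {r a b x} → QuotientDigits r a b x →
  s (r * x + 1) ((r * x + 1) * ((a * x + 1) * (b * x + 1))) ≡ r * x + 1
s-factor {r} {a} {b} {x} D =
  subst (λ n → s g (g * n) ≡ g) (sym product) (s[g*[y*[q*g+w]+1]]≡g 2≤w q<w w≤rx)
  where
  open QuotientDigits D
  open ≡-Reasoning
  g = r * x + 1
  product : (a * x + 1) * (b * x + 1) ≡ r * x * (q * g + w) + 1
  product = begin
    (a * x + 1) * (b * x + 1)     ≡⟨ expand a b x ⟩
    x * (a * b * x + a + b) + 1   ≡⟨ cong (λ n → x * n + 1) expansion ⟨
    x * (r * (q * g + w)) + 1     ≡⟨ cong (_+ 1) (reassoc x r (q * g + w)) ⟩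
    r * x * (q * g + w) + 1       ∎
    where
    expand : ∀ a b x → (a * x + 1) * (b * x + 1) ≡ x * (a * b * x + a + b) + 1
    expand = solve-∀
    reassoc : ∀ x r n → x * (r * n) ≡ r * x * n
    reassoc = solve-∀

quotientDigits-intro : ∀ {r a b x} q T →
  a * b * x + a + b ≡ q * (r * r) * x + r * T →
  q + 2 ≤ T → q + suc q ≤ T → T ≤ r * x + q → QuotientDigits r a b x
quotientDigits-intro {r} {a} {b} {x} q T eq q+2≤T q+q<T T≤rx+q
  with m≤n⇒∃[o]m+o≡n (≤-trans (m≤m+n q 2) q+2≤T)
... | w , refl = record
  { q = q ; w = w
  ; expansion = trans (shift r q x w) (sym eq)
  ; 2≤w = +-cancelˡ-≤ q 2 w q+2≤T
  ; q<w = +-cancelˡ-≤ q (suc q) w q+q<T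
  ; w≤rx = +-cancelˡ-≤ q w (r * x) (≤-trans T≤rx+q (≤-reflexive (+-comm (r * x) q)))
  }
  where
  shift : ∀ r q x w → r * (q * (r * x + 1) + w) ≡ q * (r * r) * x + r * (q + w)
  shift = solve-∀

m+n<m*n : ∀ {a b} → 2 ≤ a → 3 ≤ b → a + b < a * b
m+n<m*n {a} {b} 2≤a 3≤b with m≤n⇒∃[o]m+o≡n 2≤a | m≤n⇒∃[o]m+o≡n 3≤b
... | u , refl | v , refl = subst (suc (2 + u + (3 + v)) ≤_) (expand u v) (m≤m+n _ (2 * u + v + u * v))
  where
  expand : ∀ u v → suc (2 + u + (3 + v)) + (2 * u + v + u * v) ≡ (2 + u) * (3 + v)
  expand = solve-∀

quotientDigits-one : ∀ {a b x} → 2 ≤ a → 3 ≤ b → a * b + a * b ≤ suc (x + a + b) →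
  QuotientDigits 1 a b x
quotientDigits-one {a} {b} {x} 2≤a 3≤b 2ab≤ with m≤n⇒∃[o]m+o≡n (≤-trans (s≤s z≤n) (m+n<m*n 2≤a 3≤b))
... | q , 1+q≡ab = quotientDigits-intro q (x + a + b) eq q+2≤T q+q<T T≤x+q
  where
  a+b≤q : a + b ≤ q
  a+b≤q = ≤-pred (≤-trans (m+n<m*n 2≤a 3≤b) (≤-reflexive (sym 1+q≡ab)))
  1≤q : 1 ≤ q
  1≤q = ≤-trans (≤-trans (s≤s z≤n) 2≤a) (≤-trans (m≤m+n a b) a+b≤q)
  eq : a * b * x + a + b ≡ q * (1 * 1) * x + 1 * (x + a + b)
  eq = trans (cong (λ P → P * x + a + b) (sym 1+q≡ab)) (shift q x a b)
    where
    shift : ∀ q x a b → (1 + q) * x + a + b ≡ q * (1 * 1) * x + 1 * (x + a + b)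
    shift = solve-∀
  q+q<T : q + suc q ≤ x + a + b
  q+q<T = ≤-pred (subst (λ P → P + P ≤ suc (x + a + b)) (sym 1+q≡ab) 2ab≤)
  q+2≤T : q + 2 ≤ x + a + b
  q+2≤T = ≤-trans (+-monoʳ-≤ q (s≤s 1≤q)) q+q<T
  T≤x+q : x + a + b ≤ 1 * x + q
  T≤x+q = begin
    x + a + b   ≡⟨ +-assoc x a b ⟩
    x + (a + b) ≤⟨ +-monoʳ-≤ x a+b≤q ⟩
    x + q       ≡⟨ cong (_+ q) (*-identityˡ x) ⟨
    1 * x + q   ∎
    where open ≤-Reasoning

coprime⇒∤* : ∀ {r a b} → 2 ≤ r → Coprime r a → Coprime r b → ¬ r ∣ a * b
coprime⇒∤* 2≤r r⊥a r⊥b r∣ab = <⇒≢ 2≤r (sym (r⊥b (∣-refl , coprime-divisor r⊥a r∣ab)))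

2*q+2≤n : ∀ q {n} → 2 ≤ n → 4 * q ≤ n → 2 * q + 2 ≤ n
2*q+2≤n zero    2≤n _    = 2≤n
2*q+2≤n (suc q) _   4q≤n =
  ≤-trans (subst (2 * suc q + 2 ≤_) (expand q) (m≤m+n (2 * suc q + 2) (2 * q))) 4q≤n
  where
  expand : ∀ q → 2 * suc q + 2 + 2 * q ≡ 4 * suc q
  expand = solve-∀

m+n≤o*[m*n] : ∀ {m n o} → 1 ≤ m → 1 ≤ n → 2 ≤ o → m + n ≤ o * (m * n)
m+n≤o*[m*n] {m} {n} {o} 1≤m 1≤n 2≤o = begin
  m + n             ≤⟨ +-mono-≤ (m≤m*n m n {{>-nonZero 1≤n}}) (m≤n*m n m {{>-nonZero 1≤m}}) ⟩
  m * n + m * n     ≡⟨ cong (m * n +_) (+-identityʳ (m * n)) ⟨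
  2 * (m * n)       ≤⟨ *-monoˡ-≤ (m * n) 2≤o ⟩
  o * (m * n)       ∎
  where open ≤-Reasoning

r*[2q+2]≤cx+a+b : ∀ {r a b c q x} → 2 ≤ r → 1 ≤ a → 2 ≤ b → 1 ≤ c →
  a * b ≡ c + q * (r * r) → r * (a * b) ≤ x → r * (2 * q + 2) ≤ c * x + a + b
r*[2q+2]≤cx+a+b {r} {a} {b} {c} {q} {x} 2≤r 1≤a 2≤b 1≤c ab≡ rab≤x = begin
  r * (2 * q + 2)   ≤⟨ *-monoʳ-≤ r (2*q+2≤n q (*-mono-≤ 1≤a 2≤b) 4q≤ab) ⟩
  r * (a * b)       ≤⟨ rab≤x ⟩
  x                 ≤⟨ m≤n*m x c {{>-nonZero 1≤c}} ⟩
  c * x             ≤⟨ m≤m+n (c * x) a ⟩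
  c * x + a         ≤⟨ m≤m+n (c * x + a) b ⟩
  c * x + a + b     ∎
  where
  open ≤-Reasoning
  4q≤ab : 4 * q ≤ a * b
  4q≤ab = begin
    4 * q             ≡⟨ *-comm 4 q ⟩
    q * 4             ≤⟨ *-monoʳ-≤ q (*-mono-≤ 2≤r 2≤r) ⟩
    q * (r * r)       ≤⟨ m≤n+m (q * (r * r)) c ⟩
    c + q * (r * r)   ≡⟨ ab≡ ⟨
    a * b             ∎

cx+a+b≤r*[r*x] : ∀ {r a b c x} → 2 ≤ r → 1 ≤ a → 1 ≤ b → c < r * r →
  r * (a * b) ≤ x → c * x + a + b ≤ r * (r * x)
cx+a+b≤r*[r*x] {r} {a} {b} {c} {x} 2≤r 1≤a 1≤b c<rr rab≤x = begin
  c * x + a + b     ≡⟨ +-assoc (c * x) a b ⟩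
  c * x + (a + b)   ≤⟨ +-monoʳ-≤ (c * x) (≤-trans (m+n≤o*[m*n] 1≤a 1≤b 2≤r) rab≤x) ⟩
  c * x + x         ≡⟨ +-comm (c * x) x ⟩
  suc c * x         ≤⟨ *-monoˡ-≤ x c<rr ⟩
  r * r * x         ≡⟨ *-assoc r r x ⟩
  r * (r * x)       ∎
  where open ≤-Reasoning

quotientDigits-coprime : ∀ {r a b x} → 2 ≤ r → Coprime r a → Coprime r b → 1 ≤ a → 2 ≤ b →
  r ∣ a * b * x + a + b → r * (a * b) ≤ x → QuotientDigits r a b x
quotientDigits-coprime {r@(suc (suc _))} {a} {b} {x} 2≤r@(s≤s (s≤s z≤n)) r⊥a r⊥b 1≤a 2≤b r∣N rab≤x =
  quotientDigits-intro q T′ (trans N≡ (cong (q * (r * r) * x +_) T≡rT′))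
    (≤-trans (+-monoˡ-≤ 2 (m≤m+n q (q + 0))) 2q+2≤T′)
    (≤-trans (≤-trans (n≤1+n (q + suc q)) (≤-reflexive (double q))) 2q+2≤T′)
    (≤-trans T′≤rx (m≤m+n (r * x) q))
  where
  double : ∀ q → suc (q + suc q) ≡ 2 * q + 2
  double = solve-∀
  q = a * b / (r * r)
  c = a * b % (r * r)
  ab≡ : a * b ≡ c + q * (r * r)
  ab≡ = m≡m%n+[m/n]*n (a * b) (r * r)
  1≤c : 1 ≤ c
  1≤c = n≢0⇒n>0 λ c≡0 → coprime⇒∤* 2≤r r⊥a r⊥b (m*n∣⇒m∣ r r (m%n≡0⇒n∣m (a * b) (r * r) c≡0))
  N≡ : a * b * x + a + b ≡ q * (r * r) * x + (c * x + a + b)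
  N≡ = trans (cong (λ P → P * x + a + b) ab≡) (split c q (r * r) x a b)
    where
    split : ∀ c q s x a b → (c + q * s) * x + a + b ≡ q * s * x + (c * x + a + b)
    split = solve-∀
  r∣T : r ∣ c * x + a + b
  r∣T = ∣m+n∣m⇒∣n (subst (r ∣_) N≡ r∣N) (∣m⇒∣m*n x (∣n⇒∣m*n q (m∣m*n r)))
  T′ = quotient r∣T
  T≡rT′ : c * x + a + b ≡ r * T′
  T≡rT′ = m∣n⇒n≡m*quotient r∣T
  2q+2≤T′ : 2 * q + 2 ≤ T′
  2q+2≤T′ = *-cancelˡ-≤ r (subst (r * (2 * q + 2) ≤_) T≡rT′
              (r*[2q+2]≤cx+a+b {q = q} 2≤r 1≤a 2≤b 1≤c ab≡ rab≤x))
  T′≤rx : T′ ≤ r * x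
  T′≤rx = *-cancelˡ-≤ r (subst (_≤ r * (r * x)) T≡rT′
            (cx+a+b≤r*[r*x] 2≤r 1≤a (≤-trans (s≤s z≤n) 2≤b) (m%n<n (a * b) (r * r)) rab≤x))

strictSDecomp⇒InS : ∀ {m d ds} → IsStrictSDecomp m (d ∷ ds) → InS m
strictSDecomp⇒InS D@(_ , _ , (1<g , g<m , _) ∷ _) = <-trans (<-trans z<s 1<g) g<m , _ , D

strictSDecomp-three : ∀ {g₁ g₂ g₃} → 1 < g₁ → g₁ < g₂ → g₂ < g₃ →
  let m = g₁ * g₂ * g₃ in s g₁ m ≡ g₁ → s g₂ m ≡ g₂ → s g₃ m ≡ g₃ →
  IsStrictSDecomp m ((g₁ , 1) ∷ (g₂ , 1) ∷ (g₃ , 1) ∷ [])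
strictSDecomp-three {g₁} {g₂} {g₃} 1<g₁ g₁<g₂ g₂<g₃ s₁ s₂ s₃ =
  powers g₁ g₂ g₃ , g₁<g₂ ∷ g₂<g₃ ∷ [-] ,
  (1<g₁ , <-trans g₁<g₂ g₂<m , ≤-refl , s₁) ∷
  (1<g₂ , g₂<m , ≤-refl , s₂) ∷
  (<-trans 1<g₂ g₂<g₃ , g₃<m , ≤-refl , s₃) ∷ []
  where
  powers : ∀ a b c → a * b * c ≡ a * 1 * (b * 1 * (c * 1 * 1))
  powers = solve-∀
  1<g₂ : 1 < g₂
  1<g₂ = <-trans 1<g₁ g₁<g₂
  g₃<m : g₃ < g₁ * g₂ * g₃
  g₃<m = subst (g₃ <_) (*-comm g₃ (g₁ * g₂))
    (m<m*n g₃ (g₁ * g₂) {{>-nonZero (<-trans z<s (<-trans 1<g₂ g₂<g₃))}} (*-mono-≤ 1<g₁ (<-trans z<s 1<g₂)))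
  g₂<m : g₂ < g₁ * g₂ * g₃
  g₂<m = <-trans g₂<g₃ g₃<m

prime∣prime⇒≡ : ∀ {p q} → Prime p → Prime q → p ∣ q → p ≡ q
prime∣prime⇒≡ pp pq p∣q with prime⇒irreducible pq p∣q
... | inj₁ refl = contradiction pp ¬prime[1]
... | inj₂ p≡q  = p≡q

prime∤* : ∀ {p q r} → Prime p → Prime q → Prime r → p ≢ q → p ≢ r → ¬ p ∣ q * r
prime∤* {q = q} {r} pp pq pr p≢q p≢r p∣qr with euclidsLemma q r pp p∣qr
... | inj₁ p∣q = p≢q (prime∣prime⇒≡ pp pq p∣q)
... | inj₂ p∣r = p≢r (prime∣prime⇒≡ pp pr p∣r)

square∣p*n⇒square∣n : ∀ {p n} d → Prime p → ¬ p ∣ n → d * d ∣ p * n → d * d ∣ n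
square∣p*n⇒square∣n {p} d pp p∤n dd∣pn = coprime-divisor dd⊥p dd∣pn
  where
  instance _ = prime⇒nonZero pp
  dd⊥p : Coprime (d * d) p
  dd⊥p (e∣dd , e∣p) with prime⇒irreducible pp e∣p
  ... | inj₁ e≡1 = e≡1
  ... | inj₂ refl with euclidsLemma d d pp e∣dd
  ...   | inj₁ p∣d = contradiction (*-cancelˡ-∣ p (∣-trans (*-pres-∣ p∣d p∣d) dd∣pn)) p∤n
  ...   | inj₂ p∣d = contradiction (*-cancelˡ-∣ p (∣-trans (*-pres-∣ p∣d p∣d) dd∣pn)) p∤n

squarefree-three : ∀ {p q r} → Prime p → Prime q → Prime r → p < q → q < r → Squarefree (p * q * r)
squarefree-three {p} {q} {r} pp pq pr p<q q<r d dd∣pqr = m*n≡1⇒m≡1 d d (∣1⇒≡1 dd∣1)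
  where
  dd∣qr : d * d ∣ q * r
  dd∣qr = square∣p*n⇒square∣n d pp (prime∤* pp pq pr (<⇒≢ p<q) (<⇒≢ (<-trans p<q q<r)))
            (subst (d * d ∣_) (*-assoc p q r) dd∣pqr)
  dd∣r : d * d ∣ r
  dd∣r = square∣p*n⇒square∣n d pq (<⇒≢ q<r ∘ prime∣prime⇒≡ pq pr) dd∣qr
  dd∣1 : d * d ∣ 1
  dd∣1 = square∣p*n⇒square∣n d pr (¬prime[1] ∘ λ r∣1 → subst Prime (∣1⇒≡1 r∣1) pr)
           (subst (d * d ∣_) (sym (*-identityʳ r)) dd∣r)

prime∣three⇔ : ∀ {p q r} x → Prime x → Prime p → Prime q → Prime r →
  x ∣ p * q * r ⇔ (x ≡ p ⊎ x ≡ q ⊎ x ≡ r)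
prime∣three⇔ {p} {q} {r} x px pp pq pr = mk⇔ classify factor-∣
  where
  classify : x ∣ p * q * r → x ≡ p ⊎ x ≡ q ⊎ x ≡ r
  classify x∣pqr with euclidsLemma (p * q) r px x∣pqr
  ... | inj₂ x∣r = inj₂ (inj₂ (prime∣prime⇒≡ px pr x∣r))
  ... | inj₁ x∣pq with euclidsLemma p q px x∣pq
  ...   | inj₁ x∣p = inj₁ (prime∣prime⇒≡ px pp x∣p)
  ...   | inj₂ x∣q = inj₂ (inj₁ (prime∣prime⇒≡ px pq x∣q))
  factor-∣ : x ≡ p ⊎ x ≡ q ⊎ x ≡ r → x ∣ p * q * r
  factor-∣ (inj₁ refl)        = ∣m⇒∣m*n r (m∣m*n q)
  factor-∣ (inj₂ (inj₁ refl)) = ∣m⇒∣m*n r (n∣m*n p)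
  factor-∣ (inj₂ (inj₂ refl)) = n∣m*n (p * q)

primes⇒InC3' : ∀ {p q r} → Prime p → Prime q → Prime r → p < q → q < r →
  let m = p * q * r in s p m ≡ p → s q m ≡ q → s r m ≡ r → InC3' m
primes⇒InC3' {p} {q} {r} pp pq pr p<q q<r sp sq sr =
  1<m , squarefree-three pp pq pr p<q q<r ,
  (p , q , r , pp , pq , pr , p<q , q<r , λ x px → prime∣three⇔ x px pp pq pr) ,
  s-prime
  where
  1<m : 1 < p * q * r
  1<m = ≤-trans (nonTrivial⇒n>1 p {{prime⇒nonTrivial pp}})
          (≤-trans (m≤m*n p q {{prime⇒nonZero pq}}) (m≤m*n (p * q) r {{prime⇒nonZero pr}}))
  s-prime : ∀ x → Prime x → x ∣ p * q * r → s x (p * q * r) ≡ x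
  s-prime x px x∣m with Equivalence.to (prime∣three⇔ x px pp pq pr) x∣m
  ... | inj₁ refl        = sp
  ... | inj₂ (inj₁ refl) = sq
  ... | inj₂ (inj₂ refl) = sr

∣ab[kt+ℓ]+a+b : ∀ {r a b k} ℓ t → r ∣ k → r ∣ ℓ * σ₂ r a b + σ₁ r a b →
  r ∣ a * b * (k * t + ℓ) + a + b
∣ab[kt+ℓ]+a+b {r} {a} {b} {k} ℓ t r∣k r∣num =
  ∣m+n∣m⇒∣n (subst (r ∣_) (sym (split r a b k t ℓ)) (∣m∣n⇒∣m+n (∣n⇒∣m*n (a * b * t) r∣k) r∣num))
            (m∣m*n (ℓ * (a + b) + 1))
  where
  split : ∀ r a b k t ℓ → r * (ℓ * (a + b) + 1) + (a * b * (k * t + ℓ) + a + b)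
                        ≡ a * b * t * k + (ℓ * (r * a + r * b + a * b) + (r + a + b))
  split = solve-∀

m*[n*o]≡n*m*o : ∀ m n o → m * (n * o) ≡ n * m * o
m*[n*o]≡n*m*o = solve-∀

-- Stated unfolded: the ring solver cannot see through σ₁ and σ₂.
ℓσ₂+σ₁-swap : ∀ a b c ℓ →
  ℓ * (a * b + a * c + b * c) + (a + b + c) ≡ ℓ * (b * a + b * c + a * c) + (b + a + c)
ℓσ₂+σ₁-swap = solve-∀

ℓσ₂+σ₁-rotate : ∀ a b c ℓ →
  ℓ * (a * b + a * c + b * c) + (a + b + c) ≡ ℓ * (c * a + c * b + a * b) + (c + a + b)
ℓσ₂+σ₁-rotate = solve-∀

m≤m*n+o : ∀ k {t} ℓ → 1 ≤ t → k ≤ k * t + ℓ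
m≤m*n+o k ℓ 1≤t = ≤-trans (m≤m*n k _ {{>-nonZero 1≤t}}) (m≤m+n _ ℓ)

τ-bound : ∀ {r₂ r₃ ℓ t} → TauBound 1 r₂ r₃ ℓ t →
  r₂ * r₃ + r₂ * r₃ ≤ suc (σ₃ 1 r₂ r₃ * t + ℓ + r₂ + r₃)
τ-bound {r₂} {r₃} {ℓ} {t} (τ≤t , 1≤t) =
  subst (λ P → P + P ≤ suc (S * t + ℓ + r₂ + r₃)) (cong (_* r₃) (*-identityˡ r₂)) bound
  where
  open ≤-Reasoning
  S = σ₃ 1 r₂ r₃
  regroup : ∀ y ℓ a b → y + (ℓ + (1 + a + b)) ≡ suc (y + ℓ + a + b)
  regroup = solve-∀
  bound : S + S ≤ suc (S * t + ℓ + r₂ + r₃)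
  bound with ℓ + σ₁ 1 r₂ r₃ <? S
  ... | yes small = begin
    S + S                           ≡⟨ cong (S +_) (+-identityʳ S) ⟨
    2 * S                           ≤⟨ *-monoˡ-≤ S (τ≤t (refl , small)) ⟩
    t * S                           ≡⟨ *-comm t S ⟩
    S * t                           ≤⟨ m≤m+n (S * t) (ℓ + (1 + r₂ + r₃)) ⟩
    S * t + (ℓ + (1 + r₂ + r₃))     ≡⟨ regroup (S * t) ℓ r₂ r₃ ⟩
    suc (S * t + ℓ + r₂ + r₃)       ∎
  ... | no large = begin
    S + S                           ≤⟨ +-mono-≤ (m≤m*n S t {{>-nonZero 1≤t}}) (≮⇒≥ large) ⟩
    S * t + (ℓ + (1 + r₂ + r₃))     ≡⟨ regroup (S * t) ℓ r₂ r₃ ⟩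
    suc (S * t + ℓ + r₂ + r₃)       ∎

quotientDigits-r₁ : ∀ {r₁ r₂ r₃ ℓ t} → InR r₁ r₂ r₃ → IsEll r₁ r₂ r₃ ℓ → TauBound r₁ r₂ r₃ ℓ t →
  QuotientDigits r₁ r₂ r₃ (σ₃ r₁ r₂ r₃ * t + ℓ)
quotientDigits-r₁ {r₁} {r₂} {r₃} R E τ with r₁ ≟ 1
... | yes refl = quotientDigits-one lt₁₂ (≤-trans (s≤s lt₁₂) lt₂₃) (τ-bound {r₂} {r₃} τ)
  where open InR R
quotientDigits-r₁ {r₁} {r₂} {r₃} {ℓ} {t} R E τ | no r₁≢1 =
  quotientDigits-coprime (≤∧≢⇒< pos₁ (r₁≢1 ∘ sym)) cop₁₂ cop₁₃ (<-trans pos₁ lt₁₂)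
    (≤-trans (s≤s pos₁) (<-trans lt₁₂ lt₂₃))
    (∣ab[kt+ℓ]+a+b ℓ t r₁∣σ₃ (∣-trans r₁∣σ₃ (proj₂ E)))
    (≤-trans (≤-reflexive (sym (*-assoc r₁ r₂ r₃))) (m≤m*n+o (σ₃ r₁ r₂ r₃) ℓ (proj₂ τ)))
  where
  open InR R
  r₁∣σ₃ : r₁ ∣ σ₃ r₁ r₂ r₃
  r₁∣σ₃ = ∣m⇒∣m*n r₃ (m∣m*n r₂)

quotientDigits-r₂ : ∀ {r₁ r₂ r₃ ℓ t} → InR r₁ r₂ r₃ → IsEll r₁ r₂ r₃ ℓ → 1 ≤ t →
  QuotientDigits r₂ r₁ r₃ (σ₃ r₁ r₂ r₃ * t + ℓ)
quotientDigits-r₂ {r₁} {r₂} {r₃} {ℓ} {t} R E 1≤t =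
  quotientDigits-coprime (≤-trans (s≤s pos₁) lt₁₂) (Coprimality.sym cop₁₂) cop₂₃ pos₁
    (≤-trans (s≤s pos₁) (<-trans lt₁₂ lt₂₃))
    (∣ab[kt+ℓ]+a+b ℓ t r₂∣σ₃ (subst (r₂ ∣_) (ℓσ₂+σ₁-swap r₁ r₂ r₃ ℓ) (∣-trans r₂∣σ₃ (proj₂ E))))
    (≤-trans (≤-reflexive (m*[n*o]≡n*m*o r₂ r₁ r₃)) (m≤m*n+o (σ₃ r₁ r₂ r₃) ℓ 1≤t))
  where
  open InR R
  r₂∣σ₃ : r₂ ∣ σ₃ r₁ r₂ r₃
  r₂∣σ₃ = n∣m*n*o r₁ r₃

quotientDigits-r₃ : ∀ {r₁ r₂ r₃ ℓ t} → InR r₁ r₂ r₃ → IsEll r₁ r₂ r₃ ℓ → 1 ≤ t →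
  QuotientDigits r₃ r₁ r₂ (σ₃ r₁ r₂ r₃ * t + ℓ)
quotientDigits-r₃ {r₁} {r₂} {r₃} {ℓ} {t} R E 1≤t =
  quotientDigits-coprime (≤-trans (s≤s pos₁) (<-trans lt₁₂ lt₂₃))
    (Coprimality.sym cop₁₃) (Coprimality.sym cop₂₃) pos₁ (≤-trans (s≤s pos₁) lt₁₂)
    (∣ab[kt+ℓ]+a+b ℓ t r₃∣σ₃ (subst (r₃ ∣_) (ℓσ₂+σ₁-rotate r₁ r₂ r₃ ℓ) (∣-trans r₃∣σ₃ (proj₂ E))))
    (≤-trans (≤-reflexive (*-comm r₃ (r₁ * r₂))) (m≤m*n+o (σ₃ r₁ r₂ r₃) ℓ 1≤t))
  where
  open InR R
  r₃∣σ₃ : r₃ ∣ σ₃ r₁ r₂ r₃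
  r₃∣σ₃ = n∣m*n (r₁ * r₂)

theorem4p4 : (r₁ r₂ r₃ ℓ t : ℕ) → InR r₁ r₂ r₃ → IsEll r₁ r₂ r₃ ℓ
  → TauBound r₁ r₂ r₃ ℓ t
  → let g₁ = gfac (σ₃ r₁ r₂ r₃) ℓ t r₁
        g₂ = gfac (σ₃ r₁ r₂ r₃) ℓ t r₂
        g₃ = gfac (σ₃ r₁ r₂ r₃) ℓ t r₃
        m  = U r₁ r₂ r₃ ℓ t
    in (m ≡ g₁ * g₂ * g₃)
       × InS m
       × IsStrictSDecomp m ((g₁ , 1) ∷ (g₂ , 1) ∷ (g₃ , 1) ∷ [])
       × (OddPrime g₁ → OddPrime g₂ → OddPrime g₃ → InC3' m)
theorem4p4 r₁ r₂ r₃ ℓ t R E τ =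
  refl , strictSDecomp⇒InS decomposition , decomposition ,
  λ (p₁ , _) (p₂ , _) (p₃ , _) → primes⇒InC3' p₁ p₂ p₃ g₁<g₂ g₂<g₃ s₁ s₂ s₃
  where
  open InR R
  x = σ₃ r₁ r₂ r₃ * t + ℓ
  g₁ = r₁ * x + 1
  g₂ = r₂ * x + 1
  g₃ = r₃ * x + 1
  1≤x : 1 ≤ x
  1≤x = ≤-trans (*-mono-≤ (*-mono-≤ pos₁ (<-trans pos₁ lt₁₂)) (<-trans pos₁ (<-trans lt₁₂ lt₂₃)))
                (m≤m*n+o (σ₃ r₁ r₂ r₃) ℓ (proj₂ τ))
  g-mono : ∀ {r r′} → r < r′ → r * x + 1 < r′ * x + 1
  g-mono r<r′ = +-monoˡ-< 1 (*-monoˡ-< x {{>-nonZero 1≤x}} r<r′)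
  g₁<g₂ : g₁ < g₂
  g₁<g₂ = g-mono lt₁₂
  g₂<g₃ : g₂ < g₃
  g₂<g₃ = g-mono lt₂₃
  s₁ : s g₁ (g₁ * g₂ * g₃) ≡ g₁
  s₁ = subst (λ m → s g₁ m ≡ g₁) (sym (*-assoc g₁ g₂ g₃)) (s-factor (quotientDigits-r₁ R E τ))
  s₂ : s g₂ (g₁ * g₂ * g₃) ≡ g₂
  s₂ = subst (λ m → s g₂ m ≡ g₂) (m*[n*o]≡n*m*o g₂ g₁ g₃) (s-factor (quotientDigits-r₂ R E (proj₂ τ)))
  s₃ : s g₃ (g₁ * g₂ * g₃) ≡ g₃
  s₃ = subst (λ m → s g₃ m ≡ g₃) (*-comm g₃ (g₁ * g₂)) (s-factor (quotientDigits-r₃ R E (proj₂ τ)))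
  decomposition : IsStrictSDecomp (g₁ * g₂ * g₃) ((g₁ , 1) ∷ (g₂ , 1) ∷ (g₃ , 1) ∷ [])
  decomposition = strictSDecomp-three (+-monoˡ-≤ 1 (*-mono-≤ pos₁ 1≤x)) g₁<g₂ g₂<g₃ s₁ s₂ s₃
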